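{- Let $P$ be a partially observable plant and $D$ a diagnoser for $P$ with alarm variable $A$. Let $\beta$ be a diagnosis condition and $d\ge 0$. (i) If $D\otimes P\models G([A]_o\to Y^d\beta)\wedge G(\beta\to X^d[A]_o)$ (i.e. $D$ satisfies $\mathrm{ExactDel}(A,\beta,d)$), then $\mathrm{ExactDel}(A,\beta,d)$ is diagnosable in $P$. (ii) If $D\otimes P\models G([A]_o\to O^{\le d}\beta)\wedge G(\beta\to F^{\le d}[A]_o)$ (i.e. $D$ satisfies $\mathrm{BoundDel}(A,\beta,d)$), then $\mathrm{BoundDel}(A,\beta,d)$ is diagnosable in $P$. (iii) If $D\otimes P\models G([A]_o\to O\beta)\wedge G(\beta\to F[A]_o)$ (i.e. $D$ satisfies $\mathrm{FiniteDel}(A,\beta)$), then $\mathrm{FiniteDel}(A,\beta)$ is diagnosable in $P$.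
   Context: An LTS is $S=\langle V,E,I,\mathcal T\rangle$ (finite set $V$ of variables over a finite domain, events $E$, initial formula $I$ over $V$, transition formula $\mathcal T(e)$ over $V\cup V'$ for each $e\in E$). A trace is an infinite sequence $\sigma=s_0,e_0,s_1,e_1,\dots$ of states and events with $s_0\models I$ and $\langle s_k,s_{k+1}\rangle\models\mathcal T(e_k)$; systems are deadlock free; $\sigma^k=s_0,e_0,\dots,s_k$. $S$ is deterministic if it has exactly one initial state and each reachable state has exactly one successor per event. A plant $P=\langle V^P,E^P,I^P,\mathcal T^P,E^P_o\rangle$ is an LTS with observable events $E^P_o\subseteq E^P$. $\mathit{obs}(\sigma^k)$ is the subsequence of observable events among $e_0,\dots,e_{k-1}$; $\mathit{ObsPoint}(\sigma,i)$ iff $i>0$ and $e_{i-1}\in E_o$; $((\sigma_1,i),(\sigma_2,j))\in\mathit{ObsEq}$ iff ($\mathit{ObsPoint}(\sigma_1,i)\Leftrightarrow\mathit{ObsPoint}(\sigma_2,j)$) and $\mathit{obs}(\sigma_1^i)=\mathit{obs}(\sigma_2^j)$. A diagnoser for $P$ with alarms $\mathcal A$ is a deterministic LTS $D=\langle V^D,E^D,I^D,\mathcal T^D\rangle$ with $E^D=E^P_o$, $V^P\cap V^D=\emptyset$, and $\mathcal A\subseteq V^D$ Boolean. The asynchronous product $S^1\otimes S^2$ has variables $V^1\cup V^2$, events $E^1\cup E^2$, initial formula $I^1\wedge I^2$, and $\mathcal T(e)=\mathcal T^1(e)\wedge\bigwedge_{x\in V^2\setminus V^1}x'=x$ for $e\in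 E^1\setminus E^2$, symmetrically for $e\in E^2\setminus E^1$, and $\mathcal T^1(e)\wedge\mathcal T^2(e)$ for shared events. $D\otimes P$ is regarded as partially observable with observable events $E^P_o$. Logic: LTL with past, reflexive semantics over traces: $\sigma,i\models e$ iff $e_i=e$; $Y\beta$ iff $i>0$ and $\sigma,i-1\models\beta$; $O\beta$ iff $\exists j\le i$; $X\beta$ at $i+1$; $F\beta$ iff $\exists j\ge i$; $G\beta$ iff $\forall j\ge i$; $Y^n,X^n$ iterates; $O^{\le n}\beta=\beta\vee Y\beta\vee\dots\vee Y^n\beta$; $F^{\le n}\beta=\beta\vee X\beta\vee\dots\vee X^n\beta$. $[\phi]_o$ abbreviates $\phi\wedge Y\bigvee_{e\in E_o}e$ (so $[A]_o$ at $i$ means $A$ holds and $i$ is an observation point). A system satisfies a formula iff every trace satisfies it at position $0$. A diagnosis condition $\beta$ is a formula over plant propositions built with $\wedge,\neg,O,Y$. Diagnosability in $P$ (quantifying over traces of $P$): $\mathrm{ExactDel}(A,\beta,d)$ is diagnosable iff for all $\sigma_1,i$ with $\sigma_1,i\models\beta$: $\mathit{ObsPoint}(\sigma_1,i+d)$ and for all $\sigma_2,j$, if $((\sigma_1,i+d),(\sigma_2,j+d))\in\mathit{ObsEq}$ then $\sigma_2,j\models\beta$. $\mathrm{BoundDel}(A,\beta,d)$ is diagnosable iff for all $\sigma_1,i$ with $\sigma_1,i\models\beta$ there is $k$, $i\le k\le i+d$, with $\mathit{ObsPoint}(\sigma_1,k)$ and for all $\sigma_2,l$ with $((\sigma_1,k),(\sigma_2,l))\in\mathit{ObsEq}$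 there is $j$, $l-d\le j\le l$, with $\sigma_2,j\models\beta$. $\mathrm{FiniteDel}(A,\beta)$ is diagnosable iff for all $\sigma_1,i$ with $\sigma_1,i\models\beta$ there is $k\ge i$ with $\mathit{ObsPoint}(\sigma_1,k)$ and for all $\sigma_2,l$ with $((\sigma_1,k),(\sigma_2,l))\in\mathit{ObsEq}$ there is $j\le l$ with $\sigma_2,j\models\beta$. -}

module Defs where

open import Data.Nat using (ℕ; zero; suc; _+_; _∸_; _≤_)
open import Data.Fin using (Fin)
open import Data.Bool using (Bool; true; false)
open import Data.List using (List; []; _∷_; _++_)
open import Data.Sum using (_⊎_; inj₁; inj₂; [_,_])
open import Data.Product using (Σ; Σ-syntax; _×_; _,_; proj₁; proj₂)
open import Data.Empty using (⊥)
open import Relation.Nullary using (¬_)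
open import Relation.Binary.PropositionalEquality using (_≡_; refl; subst)
open import Function using (_∘_; id)
open import Function.Bundles using (_↔_)

Finite : Set → Set
Finite A = Σ ℕ λ n → A ↔ Fin n

-- A state is a valuation of the variables; formulas over V (resp. V ∪ V')
-- are represented semantically as predicates on states (resp. pairs of
-- states (s, s')).

record LTS (Ev : Set) : Set₁ where
  field
    Var  : Set
    Dom  : Var → Set
    Init : ((x : Var) → Dom x) → Set
    Tr   : Ev → ((x : Var) → Dom x) → ((x : Var) → Dom x) → Set

  State : Set
  State = (x : Var) → Dom x

open LTS public

_≈ₛ_ : {V : Set} {D : V → Set} → ((x : V) → D x) → ((x : V) → D x) → Set
s ≈ₛ t = ∀ x → s x ≡ t x

FiniteLTS : {Ev : Set} → LTS Ev → Set
FiniteLTS S = Finite (Var S) × (∀ x → Finite (Dom S x))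

record Trace {Ev : Set} (S : LTS Ev) : Set where
  field
    st   : ℕ → State S
    ev   : ℕ → Ev
    init : Init S (st 0)
    step : ∀ k → Tr S (ev k) (st k) (st (suc k))

open Trace public

data Reachable {Ev : Set} (S : LTS Ev) : State S → Set where
  reach-init : ∀ {s} → Init S s → Reachable S s
  reach-step : ∀ {s s' e} → Reachable S s → Tr S e s s' → Reachable S s'

DeadlockFree : {Ev : Set} → LTS Ev → Set
DeadlockFree S = ∀ s → Reachable S s → Σ[ e ∈ _ ] Σ[ s' ∈ State S ] Tr S e s s'

Deterministic : {Ev : Set} → LTS Ev → Set
Deterministic {Ev} S =
  (Σ[ s₀ ∈ State S ] (Init S s₀ × (∀ s → Init S s → s ≈ₛ s₀)))
  × (∀ s → Reachable S s → (e : Ev) →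
       Σ[ s' ∈ State S ] (Tr S e s s' × (∀ s'' → Tr S e s s'' → s'' ≈ₛ s')))

record Plant : Set₁ where
  field
    nE       : ℕ
    obs      : Fin nE → Bool
    lts      : LTS (Fin nE)
    finite   : FiniteLTS lts
    deadlockFree : DeadlockFree lts

open Plant public

PState : Plant → Set
PState P = State (lts P)

ObsEv : Plant → Set
ObsEv P = Σ[ e ∈ Fin (nE P) ] obs P e ≡ true

-- Diagnosers: deterministic LTS with E^D = E^P_o and a Boolean alarm
-- variable A.  V^P ∩ V^D = ∅ is built in: the product uses V^D ⊎ V^P.

record Diagnoser (P : Plant) : Set₁ where
  field
    dlts          : LTS (ObsEv P)
    dfinite       : FiniteLTS dlts
    deterministic : Deterministic dlts
    alarm         : Var dlts
    alarmBool     : Dom dlts alarm ≡ Bool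

open Diagnoser public

DState : {P : Plant} → Diagnoser P → Set
DState D = State (dlts D)

alarmOn : {P : Plant} (D : Diagnoser P) → DState D → Set
alarmOn D s = subst id (alarmBool D) (s (alarm D)) ≡ true

module _ {P : Plant} (D : Diagnoser P) where

  ProdVar : Set
  ProdVar = Var (dlts D) ⊎ Var (lts P)

  ProdDom : ProdVar → Set
  ProdDom = [ Dom (dlts D) , Dom (lts P) ]

  -- diagnoser part of a transition: T^D(e) for shared (observable) events,
  -- frame condition x' = x for x ∈ V^D on plant-only events
  TrDpart : (e : Fin (nE P)) (b : Bool) → obs P e ≡ b → DState D → DState D → Set
  TrDpart e true  p d d' = Tr (dlts D) (e , p) d d'
  TrDpart e false _ d d' = ∀ x → d' x ≡ d x

  D⊗P : LTS (Fin (nE P))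
  D⊗P = record
    { Var  = ProdVar
    ; Dom  = ProdDom
    ; Init = λ s → Init (dlts D) (s ∘ inj₁) × Init (lts P) (s ∘ inj₂)
    ; Tr   = λ e s s' → TrDpart e (obs P e) refl (s ∘ inj₁) (s' ∘ inj₁)
                         × Tr (lts P) e (s ∘ inj₂) (s' ∘ inj₂)
    }

Yₒ : (ℕ → Set) → ℕ → Set
Yₒ Q zero    = ⊥
Yₒ Q (suc i) = Q i

Xₒ : (ℕ → Set) → ℕ → Set
Xₒ Q i = Q (suc i)

Yⁿ : ℕ → (ℕ → Set) → ℕ → Set
Yⁿ zero    Q = Q
Yⁿ (suc n) Q = Yₒ (Yⁿ n Q)

Xⁿ : ℕ → (ℕ → Set) → ℕ → Set
Xⁿ zero    Q = Q
Xⁿ (suc n) Q = Xₒ (Xⁿ n Q)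

Oₒ : (ℕ → Set) → ℕ → Set
Oₒ Q i = Σ[ j ∈ ℕ ] (j ≤ i × Q j)

Fₒ : (ℕ → Set) → ℕ → Set
Fₒ Q i = Σ[ j ∈ ℕ ] (i ≤ j × Q j)

Gₒ : (ℕ → Set) → ℕ → Set
Gₒ Q i = ∀ j → i ≤ j → Q j

O≤ : ℕ → (ℕ → Set) → ℕ → Set
O≤ n Q i = Σ[ k ∈ ℕ ] (k ≤ n × Yⁿ k Q i)

F≤ : ℕ → (ℕ → Set) → ℕ → Set
F≤ n Q i = Σ[ k ∈ ℕ ] (k ≤ n × Xⁿ k Q i)

_⇒ₒ_ : (ℕ → Set) → (ℕ → Set) → ℕ → Set
(Q ⇒ₒ R) i = Q i → R i

_∧ₒ_ : (ℕ → Set) → (ℕ → Set) → ℕ → Set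
(Q ∧ₒ R) i = Q i × R i

ObsPoint : (P : Plant) → (ℕ → Fin (nE P)) → ℕ → Set
ObsPoint P ev = Yₒ (λ k → obs P (ev k) ≡ true)

obsSeq : (P : Plant) → (ℕ → Fin (nE P)) → ℕ → List (Fin (nE P))
obsSeq P ev zero    = []
obsSeq P ev (suc k) = obsSeq P ev k ++ keep (obs P (ev k))
  where
  keep : Bool → List (Fin (nE P))
  keep true  = ev k ∷ []
  keep false = []

ObsEq : (P : Plant) → Trace (lts P) → ℕ → Trace (lts P) → ℕ → Set
ObsEq P σ₁ i σ₂ j =
  ((ObsPoint P (ev σ₁) i → ObsPoint P (ev σ₂) j)
   × (ObsPoint P (ev σ₂) j → ObsPoint P (ev σ₁) i))
  × obsSeq P (ev σ₁) i ≡ obsSeq P (ev σ₂) j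

data DCond (P : Plant) : Set₁ where
  atom  : (PState P → Set) → DCond P
  event : Fin (nE P) → DCond P
  _∧ᶜ_  : DCond P → DCond P → DCond P
  ¬ᶜ_   : DCond P → DCond P
  Oᶜ    : DCond P → DCond P
  Yᶜ    : DCond P → DCond P

⟦_⟧ : {P : Plant} → DCond P → (ℕ → PState P) → (ℕ → Fin (nE P)) → ℕ → Set
⟦ atom p  ⟧ st ev i = p (st i)
⟦ event e ⟧ st ev i = ev i ≡ e
⟦ β ∧ᶜ γ  ⟧ st ev i = ⟦ β ⟧ st ev i × ⟦ γ ⟧ st ev i
⟦ ¬ᶜ β    ⟧ st ev i = ¬ ⟦ β ⟧ st ev i
⟦ Oᶜ β    ⟧ st ev i = Oₒ (⟦ β ⟧ st ev) i
⟦ Yᶜ β    ⟧ st ev i = Yₒ (⟦ β ⟧ st ev) i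

βP : {P : Plant} → DCond P → Trace (lts P) → ℕ → Set
βP β σ = ⟦ β ⟧ (st σ) (ev σ)

module _ {P : Plant} (D : Diagnoser P) where

  βDP : DCond P → Trace (D⊗P D) → ℕ → Set
  βDP β τ = ⟦ β ⟧ (λ i → st τ i ∘ inj₂) (ev τ)

  Alarmₒ : Trace (D⊗P D) → ℕ → Set
  Alarmₒ τ = (λ i → alarmOn D (st τ i ∘ inj₁)) ∧ₒ ObsPoint P (ev τ)

  _⊨_ : (Trace (D⊗P D) → ℕ → Set) → Set
  _⊨_ φ = ∀ τ → φ τ 0

module _ {P : Plant} where

  ExactDelDiagnosable : DCond P → ℕ → Set
  ExactDelDiagnosable β d =
    ∀ (σ₁ : Trace (lts P)) i → βP β σ₁ i →
      ObsPoint P (ev σ₁) (i + d)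
      × (∀ (σ₂ : Trace (lts P)) j → ObsEq P σ₁ (i + d) σ₂ (j + d) → βP β σ₂ j)

  BoundDelDiagnosable : DCond P → ℕ → Set
  BoundDelDiagnosable β d =
    ∀ (σ₁ : Trace (lts P)) i → βP β σ₁ i →
      Σ[ k ∈ ℕ ] (i ≤ k × k ≤ i + d × ObsPoint P (ev σ₁) k
        × (∀ (σ₂ : Trace (lts P)) l → ObsEq P σ₁ k σ₂ l →
             Σ[ j ∈ ℕ ] (l ∸ d ≤ j × j ≤ l × βP β σ₂ j)))

  FiniteDelDiagnosable : DCond P → Set
  FiniteDelDiagnosable β =
    ∀ (σ₁ : Trace (lts P)) i → βP β σ₁ i →
      Σ[ k ∈ ℕ ] (i ≤ k × ObsPoint P (ev σ₁) k
        × (∀ (σ₂ : Trace (lts P)) l → ObsEq P σ₁ k σ₂ l →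
             Σ[ j ∈ ℕ ] (j ≤ l × βP β σ₂ j)))

-- A diagnoser is deterministic and only reacts to observable events, so along
-- the product run of a plant trace its state at position k is a function of
-- obs(σ^k) alone. Every plant trace therefore lifts to a trace of D ⊗ P, and
-- [A]_o holds at a point of one lifted trace iff it holds at every
-- observationally equivalent point of another. Diagnosability then follows
-- by transporting the alarm that β raises on σ₁ to σ₂ and reading β back off
-- the alarm on σ₂.
module Submission where

open import Defs
open import Data.Nat using (ℕ; zero; suc; _+_; _∸_; z≤n)
open import Data.Nat.Properties using (+-identityʳ; +-suc; m+n∸n≡m; ∸-monoʳ-≤; m∸n≤m; m≤m+n; +-monoʳ-≤)
open import Data.Product using (Σ; _×_; _,_; proj₁; proj₂)
open import Data.Bool using (Bool; true; false)
open import Data.Fin using (Fin)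
open import Data.List using (List; []; _∷_; _++_)
open import Data.Sum using (inj₁; inj₂)
open import Relation.Binary.PropositionalEquality using (_≡_; refl; subst; sym; cong; module ≡-Reasoning)
open ≡-Reasoning

Gₒ-everywhere : {Q : ℕ → Set} → Gₒ Q 0 → ∀ j → Q j
Gₒ-everywhere g j = g j z≤n

Yⁿ⇒∸ : {Q : ℕ → Set} → ∀ n i → Yⁿ n Q i → Q (i ∸ n)
Yⁿ⇒∸ zero    i       q = q
Yⁿ⇒∸ (suc n) (suc i) q = Yⁿ⇒∸ n i q

Xⁿ⇒+ : {Q : ℕ → Set} → ∀ n i → Xⁿ n Q i → Q (i + n)
Xⁿ⇒+ {Q} zero    i q = subst Q (sym (+-identityʳ i)) q
Xⁿ⇒+ {Q} (suc n) i q = subst Q (sym (+-suc i n)) (Xⁿ⇒+ n (suc i) q)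

module DiagnoserRun {P : Plant} (D : Diagnoser P) where

  ReachableState : Set
  ReachableState = Σ (DState D) (Reachable (dlts D))

  initial : ReachableState
  initial = proj₁ (proj₁ (deterministic D)) , reach-init (proj₁ (proj₂ (proj₁ (deterministic D))))

  -- The observability bit is abstracted so that we can match on it while
  -- keeping the proof of observability that TrDpart demands.
  react : ReachableState → (e : Fin (nE P)) (b : Bool) → obs P e ≡ b → ReachableState
  react (s , r) e true  p = let (s' , t , _) = proj₂ (deterministic D) s r (e , p) in s' , reach-step r t
  react s       e false p = s

  react-TrDpart : ∀ s e b (p : obs P e ≡ b) → TrDpart D e b p (proj₁ s) (proj₁ (react s e b p))
  react-TrDpart (s , r) e true  p = proj₁ (proj₂ (proj₂ (deterministic D) s r (e , p)))
  react-TrDpart s       e false p = λ _ → refl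

  react-canonical : ∀ s e b (p : obs P e ≡ b) → react s e (obs P e) refl ≡ react s e b p
  react-canonical s e b refl = refl

  runFrom : ReachableState → List (Fin (nE P)) → ReachableState
  runFrom s []      = s
  runFrom s (e ∷ l) = runFrom (react s e (obs P e) refl) l

  runFrom-++ : ∀ s l m → runFrom s (l ++ m) ≡ runFrom (runFrom s l) m
  runFrom-++ s []      m = refl
  runFrom-++ s (e ∷ l) m = runFrom-++ _ l m

  observed : Fin (nE P) → Bool → List (Fin (nE P))
  observed e true  = e ∷ []
  observed e false = []

  runFrom-observed : ∀ s e b (p : obs P e ≡ b) → runFrom s (observed e b) ≡ react s e b p
  runFrom-observed s e true  p = react-canonical s e true p
  runFrom-observed s e false p = refl

  obsSeq-suc : (ev : ℕ → Fin (nE P)) → ∀ k →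
    obsSeq P ev (suc k) ≡ obsSeq P ev k ++ observed (ev k) (obs P (ev k))
  obsSeq-suc ev k with obs P (ev k)
  ... | true  = refl
  ... | false = refl

  run : List (Fin (nE P)) → ReachableState
  run = runFrom initial

  run-obsSeq-suc : (ev : ℕ → Fin (nE P)) → ∀ k →
    run (obsSeq P ev (suc k)) ≡ react (run (obsSeq P ev k)) (ev k) (obs P (ev k)) refl
  run-obsSeq-suc ev k = begin
    run (obsSeq P ev (suc k))
      ≡⟨ cong run (obsSeq-suc ev k) ⟩
    run (obsSeq P ev k ++ observed (ev k) (obs P (ev k)))
      ≡⟨ runFrom-++ initial (obsSeq P ev k) _ ⟩
    runFrom (run (obsSeq P ev k)) (observed (ev k) (obs P (ev k)))
      ≡⟨ runFrom-observed _ (ev k) (obs P (ev k)) refl ⟩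
    react (run (obsSeq P ev k)) (ev k) (obs P (ev k)) refl ∎

  pair : DState D → PState P → State (D⊗P D)
  pair d p (inj₁ x) = d x
  pair d p (inj₂ x) = p x

  lift : Trace (lts P) → Trace (D⊗P D)
  lift σ = record
    { st   = λ k → pair (diag k) (st σ k)
    ; ev   = ev σ
    ; init = proj₁ (proj₂ (proj₁ (deterministic D))) , init σ
    ; step = λ k → diag-step k , step σ k
    }
    where
    diag : ℕ → DState D
    diag k = proj₁ (run (obsSeq P (ev σ) k))

    diag-step : ∀ k → TrDpart D (ev σ k) (obs P (ev σ k)) refl (diag k) (diag (suc k))
    diag-step k =
      subst (λ r → TrDpart D (ev σ k) (obs P (ev σ k)) refl (diag k) (proj₁ r))
            (sym (run-obsSeq-suc (ev σ) k))
            (react-TrDpart (run (obsSeq P (ev σ) k)) (ev σ k) (obs P (ev σ k)) refl)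

  Alarmₒ-lift-ObsEq : ∀ σ₁ k σ₂ l → ObsEq P σ₁ k σ₂ l →
    Alarmₒ D (lift σ₁) k → Alarmₒ D (lift σ₂) l
  Alarmₒ-lift-ObsEq _ _ _ _ ((point₁⇒point₂ , _) , same-obs) (alarm , point₁) =
    subst (λ L → alarmOn D (proj₁ (run L))) same-obs alarm , point₁⇒point₂ point₁

open DiagnoserRun using (lift; Alarmₒ-lift-ObsEq)

module _ {P : Plant} (D : Diagnoser P) (β : DCond P) where

  SatisfiesExactDel : ℕ → Set
  SatisfiesExactDel d = D ⊨ λ τ → Gₒ (Alarmₒ D τ ⇒ₒ Yⁿ d (βDP D β τ)) ∧ₒ
                                    Gₒ (βDP D β τ ⇒ₒ Xⁿ d (Alarmₒ D τ))

  SatisfiesBoundDel : ℕ → Set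
  SatisfiesBoundDel d = D ⊨ λ τ → Gₒ (Alarmₒ D τ ⇒ₒ O≤ d (βDP D β τ)) ∧ₒ
                                    Gₒ (βDP D β τ ⇒ₒ F≤ d (Alarmₒ D τ))

  SatisfiesFiniteDel : Set
  SatisfiesFiniteDel = D ⊨ λ τ → Gₒ (Alarmₒ D τ ⇒ₒ Oₒ (βDP D β τ)) ∧ₒ
                                   Gₒ (βDP D β τ ⇒ₒ Fₒ (Alarmₒ D τ))

  exactDel-diagnosable : ∀ d → SatisfiesExactDel d → ExactDelDiagnosable β d
  exactDel-diagnosable d H σ₁ i βᵢ = proj₂ alarm₁ , λ σ₂ j equiv →
      subst (βP β σ₂) (m+n∸n≡m j d)
        (Yⁿ⇒∸ d (j + d)
          (Gₒ-everywhere (proj₁ (H (lift D σ₂))) (j + d)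
            (Alarmₒ-lift-ObsEq D σ₁ (i + d) σ₂ (j + d) equiv alarm₁)))
    where
    alarm₁ : Alarmₒ D (lift D σ₁) (i + d)
    alarm₁ = Xⁿ⇒+ d i (Gₒ-everywhere (proj₂ (H (lift D σ₁))) i βᵢ)

  boundDel-diagnosable : ∀ d → SatisfiesBoundDel d → BoundDelDiagnosable β d
  boundDel-diagnosable d H σ₁ i βᵢ
    with Gₒ-everywhere (proj₂ (H (lift D σ₁))) i βᵢ
  ... | delay , delay≤d , later =
      i + delay , m≤m+n i delay , +-monoʳ-≤ i delay≤d , proj₂ alarm₁ , λ σ₂ l equiv →
        let (back , back≤d , earlier) =
              Gₒ-everywhere (proj₁ (H (lift D σ₂))) l
                (Alarmₒ-lift-ObsEq D σ₁ (i + delay) σ₂ l equiv alarm₁)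
        in l ∸ back , ∸-monoʳ-≤ l back≤d , m∸n≤m l back , Yⁿ⇒∸ back l earlier
    where
    alarm₁ : Alarmₒ D (lift D σ₁) (i + delay)
    alarm₁ = Xⁿ⇒+ delay i later

  finiteDel-diagnosable : SatisfiesFiniteDel → FiniteDelDiagnosable β
  finiteDel-diagnosable H σ₁ i βᵢ
    with Gₒ-everywhere (proj₂ (H (lift D σ₁))) i βᵢ
  ... | k , i≤k , alarm₁ = k , i≤k , proj₂ alarm₁ , λ σ₂ l equiv →
      Gₒ-everywhere (proj₁ (H (lift D σ₂))) l (Alarmₒ-lift-ObsEq D σ₁ k σ₂ l equiv alarm₁)

theorem3p8 : (P : Plant) (D : Diagnoser P) (β : DCond P) (d : ℕ) →
    ((D ⊨ λ τ → Gₒ (Alarmₒ D τ ⇒ₒ Yⁿ d (βDP D β τ)) ∧ₒ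
                 Gₒ (βDP D β τ ⇒ₒ Xⁿ d (Alarmₒ D τ)))
      → ExactDelDiagnosable β d)
  × ((D ⊨ λ τ → Gₒ (Alarmₒ D τ ⇒ₒ O≤ d (βDP D β τ)) ∧ₒ
                 Gₒ (βDP D β τ ⇒ₒ F≤ d (Alarmₒ D τ)))
      → BoundDelDiagnosable β d)
  × ((D ⊨ λ τ → Gₒ (Alarmₒ D τ ⇒ₒ Oₒ (βDP D β τ)) ∧ₒ
                 Gₒ (βDP D β τ ⇒ₒ Fₒ (Alarmₒ D τ)))
      → FiniteDelDiagnosable β)
theorem3p8 P D β d =
  exactDel-diagnosable D β d , boundDel-diagnosable D β d , finiteDel-diagnosable D β
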